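{- Let $D$ be a signed digraph on $[n]$ and $s\ge2$. For every non-empty independent set $Z$ of the guessing graph $\mathrm{G}(D,s)$ there exists $f\in F(D,s)$ such that $Z\subseteq\mathrm{Fix}(f)$. Consequently $g(D,s)=\log_s\alpha(\mathrm{G}(D,s))$, where $\alpha$ denotes the independence number.
   Context: A signed digraph on $[n]=\{0,\dots,n-1\}$ is $D=([n],E,\lambda)$ with $E\subseteq[n]\times[n]$ (loops allowed) and $\lambda:E\to\{ -1,0,1\}$. For $i\in[n]$, $N^\alpha(i)=\{j:(j,i)\in E,\lambda(j,i)=\alpha\}$ and $N(i)$ is their union. $[s]=\{0,\dots,s-1\}$. $F(D,s)$ is the set of maps $f=(f_0,\dots,f_{n-1}):[s]^n\to[s]^n$ such that each $f_i$ depends only on $x_{N(i)}$, is non-decreasing in $x_j$ when $\lambda(j,i)=1$ and non-increasing in $x_j$ when $\lambda(j,i)=-1$. $\mathrm{Fix}(f)$ is the set of fixed points of $f$, and $g(D,s)=\max_{f\in F(D,s)}\log_s|\mathrm{Fix}(f)|$. The guessing graph $\mathrm{G}(D,s)$ is the simple graph on $[s]^n$ where distinct $x,y$ are adjacent iff no $f\in F(D,s)$ has both $x,y\in\mathrm{Fix}(f)$. -}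

module Defs where

open import Data.Nat using (ℕ; _≤_)
open import Data.Fin as Fin using (Fin)
open import Data.Vec using (Vec; lookup)
open import Data.Maybe using (Maybe; just; nothing)
open import Data.List using (List; length; [])
open import Data.List.Membership.Propositional using (_∈_)
open import Data.List.Relation.Unary.Unique.Propositional using (Unique)
open import Data.Product using (Σ; ∃; _×_)
open import Relation.Binary.PropositionalEquality using (_≡_; _≢_)
open import Relation.Nullary using (¬_)
open import Function.Bundles using (_⇔_)

data Sign : Set where
  neg zer pos : Sign

-- A signed digraph on [n]: sd j i = nothing if (j,i) ∉ E,
-- and sd j i = just α if (j,i) ∈ E with λ(j,i) = α.  Loops allowed.
SignedDigraph : ℕ → Set
SignedDigraph n = Fin n → Fin n → Maybe Sign

Conf : ℕ → ℕ → Set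
Conf n s = Vec (Fin s) n

InN : ∀ {n} → SignedDigraph n → Fin n → Fin n → Set
InN D j i = D j i ≢ nothing

AgreeExcept : ∀ {n s} → Fin n → Conf n s → Conf n s → Set
AgreeExcept j x y = ∀ k → k ≢ j → lookup x k ≡ lookup y k

record InF {n s : ℕ} (D : SignedDigraph n)
           (f : Conf n s → Conf n s) : Set where
  field
    local : ∀ i (x y : Conf n s) →
            (∀ j → InN D j i → lookup x j ≡ lookup y j) →
            lookup (f x) i ≡ lookup (f y) i
    mono⁺ : ∀ i j → D j i ≡ just pos → ∀ (x y : Conf n s) →
            AgreeExcept j x y → lookup x j Fin.≤ lookup y j →
            lookup (f x) i Fin.≤ lookup (f y) i
    mono⁻ : ∀ i j → D j i ≡ just neg → ∀ (x y : Conf n s) →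
            AgreeExcept j x y → lookup x j Fin.≤ lookup y j →
            lookup (f y) i Fin.≤ lookup (f x) i

IsFix : ∀ {n s} → (Conf n s → Conf n s) → Conf n s → Set
IsFix f x = f x ≡ x

FixCount : ∀ {n s} → (Conf n s → Conf n s) → ℕ → Set
FixCount {n} {s} f m =
  Σ (List (Conf n s)) λ L → Unique L × (∀ x → (x ∈ L) ⇔ IsFix f x) × (length L ≡ m)

Adj : ∀ {n} s → SignedDigraph n → Conf n s → Conf n s → Set
Adj {n} s D x y =
  x ≢ y × ¬ (Σ (Conf n s → Conf n s) λ f → InF D f × IsFix f x × IsFix f y)

Independent : ∀ {n} s → SignedDigraph n → List (Conf n s) → Set
Independent s D Z = Unique Z × (∀ x y → x ∈ Z → y ∈ Z → ¬ Adj s D x y)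

-- m = max_{f ∈ F(D,s)} |Fix(f)|   (so g(D,s) = log_s m)
IsMaxFix : ∀ {n} s → SignedDigraph n → ℕ → Set
IsMaxFix {n} s D m =
  (Σ (Conf n s → Conf n s) λ f → InF D f × FixCount f m) ×
  (∀ f k → InF D f → FixCount {n} {s} f k → k ≤ m)

IsIndepNumber : ∀ {n} s → SignedDigraph n → ℕ → Set
IsIndepNumber s D m =
  (Σ _ λ Z → Independent s D Z × length Z ≡ m) ×
  (∀ Z → Independent s D Z → length Z ≤ m)

module Submission where

-- For a vertex i write x ≼⟨ i ⟩ y when every in-neighbour j of i moves from
-- x to y in the direction allowed by the sign of (j,i): up for an activation,
-- down for an inhibition, not at all for a neutral arc.  The proof rests on
-- the observation that the functions of F(D,s) are exactly the maps f whose
-- i-th coordinate is monotone for ≼⟨ i ⟩, for every i: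
--   * inF⇒monotone walks from x to y one coordinate at a time, each step
--     being controlled by locality or by one of the two monotonicity axioms;
--   * monotone⇒inF recovers the three axioms as special cases.
-- Consequently two common fixed points x, y with x ≼⟨ i ⟩ y and x_i > y_i
-- are adjacent in G(D,s), so an independent set Z is "separated".  For a
-- separated Z the map  fromSet Z  with  f_i(z) = max { a_i : a ∈ Z, a ≼⟨ i ⟩ z }
-- is monotone, hence in F(D,s), and fixes every point of Z (first claim).
-- Since conversely Fix(f) is independent for every f ∈ F(D,s), the largest
-- fixed point sets and the largest independent sets have the same size
-- (second claim); the counting uses an explicit enumeration of [s]^n.

open import Defs
open import Data.Nat using (ℕ; _≤_)
open import Data.List using (List; [])
open import Data.List.Membership.Propositional using (_∈_)
open import Data.Product using (Σ; _×_)
open import Relation.Binary.PropositionalEquality using (_≢_)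
open import Function.Bundles using (_⇔_)

import Data.Nat as ℕ
import Data.Nat.Properties as ℕP
open import Data.Fin as F using (Fin)
import Data.Fin.Properties as FP
open import Data.Vec as V using (lookup; tabulate; _[_]≔_)
import Data.Vec.Properties as VP
open import Data.Maybe using (Maybe; just; nothing)
open import Data.List
  using (_∷_; length; map; filter; deduplicate; allFin; cartesianProductWith)
open import Data.List.Relation.Unary.Any using (here; there)
import Data.List.Relation.Unary.All as All
open import Data.List.Relation.Unary.AllPairs using (_∷_)
open import Data.List.Relation.Unary.Unique.Propositional using (Unique)
import Data.List.Relation.Unary.Unique.Propositional.Properties as Unique
import Data.List.Relation.Unary.Unique.DecPropositional.Properties as DecUnique
open import Data.List.Membership.Propositional.Properties
  using (∈-map⁺; ∈-map⁻; ∈-filter⁺; ∈-filter⁻; ∈-deduplicate⁺; ∈-allFin;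
         ∈-cartesianProductWith⁺)
open import Data.List.Relation.Binary.Subset.Propositional using (_⊆_)
import Data.List.Relation.Binary.Subset.Propositional.Properties as Subset
open import Data.Product using (_,_; proj₁; proj₂)
open import Data.Unit using (⊤; tt)
open import Data.Empty using (⊥-elim)
open import Relation.Nullary using (Dec; yes; no; ¬_)
open import Relation.Binary.PropositionalEquality
  using (_≡_; refl; sym; trans; cong; subst; subst₂)
open import Function.Bundles using (mk⇔; Equivalence)

_⊑⟨_⟩_ : ∀ {s} → Fin s → Maybe Sign → Fin s → Set
a ⊑⟨ nothing ⟩ b = ⊤
a ⊑⟨ just pos ⟩ b = a F.≤ b
a ⊑⟨ just neg ⟩ b = b F.≤ a
a ⊑⟨ just zer ⟩ b = a ≡ b

⊑-reflexive : ∀ {s} σ {a b : Fin s} → a ≡ b → a ⊑⟨ σ ⟩ b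
⊑-reflexive nothing _ = tt
⊑-reflexive (just pos) a≡b = FP.≤-reflexive a≡b
⊑-reflexive (just neg) a≡b = FP.≤-reflexive (sym a≡b)
⊑-reflexive (just zer) a≡b = a≡b

⊑-trans : ∀ {s} σ {a b c : Fin s} → a ⊑⟨ σ ⟩ b → b ⊑⟨ σ ⟩ c → a ⊑⟨ σ ⟩ c
⊑-trans nothing _ _ = tt
⊑-trans (just pos) a≤b b≤c = FP.≤-trans a≤b b≤c
⊑-trans (just neg) b≤a c≤b = FP.≤-trans c≤b b≤a
⊑-trans (just zer) a≡b b≡c = trans a≡b b≡c

⊑-dec : ∀ {s} σ (a b : Fin s) → Dec (a ⊑⟨ σ ⟩ b)
⊑-dec nothing _ _ = yes tt
⊑-dec (just pos) a b = a FP.≤? b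
⊑-dec (just neg) a b = b FP.≤? a
⊑-dec (just zer) a b = a FP.≟ b

agree-everywhere : ∀ {n s} {j : Fin n} {x y : Conf n s} → AgreeExcept j x y →
                   lookup x j ≡ lookup y j → ∀ k → lookup x k ≡ lookup y k
agree-everywhere {j = j} x~y xj≡yj k with k FP.≟ j
... | yes refl = xj≡yj
... | no k≢j = x~y k k≢j

update-agreeExcept : ∀ {n s} (z : Conf n s) j a → AgreeExcept j z (z [ j ]≔ a)
update-agreeExcept z j a k k≢j = sym (VP.lookup∘update′ k≢j z a)

configurations : ∀ s n → List (Conf n s)
configurations s ℕ.zero = V.[] ∷ []
configurations s (ℕ.suc n) =
  cartesianProductWith V._∷_ (allFin s) (configurations s n)

∈-configurations : ∀ {s n} (x : Conf n s) → x ∈ configurations s n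
∈-configurations V.[] = here refl
∈-configurations (a V.∷ x) =
  ∈-cartesianProductWith⁺ V._∷_ (∈-allFin a) (∈-configurations x)

_≟ᶜ_ : ∀ {n s} (x y : Conf n s) → Dec (x ≡ y)
_≟ᶜ_ = VP.≡-dec FP._≟_

fixedPoints : ∀ {n s} → (Conf n s → Conf n s) → List (Conf n s)
fixedPoints {n} {s} f =
  filter (λ x → f x ≟ᶜ x) (deduplicate _≟ᶜ_ (configurations s n))

∈-fixedPoints : ∀ {n s} {f : Conf n s → Conf n s} {x} → IsFix f x → x ∈ fixedPoints f
∈-fixedPoints {f = f} {x} =
  ∈-filter⁺ (λ x → f x ≟ᶜ x) (∈-deduplicate⁺ _≟ᶜ_ (∈-configurations x))

fixedPoints-count : ∀ {n s} (f : Conf n s → Conf n s) →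
                    FixCount f (length (fixedPoints f))
fixedPoints-count {n} {s} f =
  fixedPoints f ,
  Unique.filter⁺ (λ x → f x ≟ᶜ x) (DecUnique.deduplicate-! _≟ᶜ_ (configurations s n)) ,
  (λ x → mk⇔ (λ x∈ → proj₂ (∈-filter⁻ (λ x → f x ≟ᶜ x) {xs = dedup} x∈))
             ∈-fixedPoints) ,
  refl
  where
  dedup : List (Conf n s)
  dedup = deduplicate _≟ᶜ_ (configurations s n)

remove : ∀ {A : Set} {z : A} (ys : List A) → z ∈ ys →
         Σ (List A) λ ys′ → ℕ.suc (length ys′) ≡ length ys ×
                             (∀ {w} → w ∈ ys → w ≢ z → w ∈ ys′)
remove (y ∷ ys) (here refl) = ys , refl , keep
  where
  keep : ∀ {w} → w ∈ y ∷ ys → w ≢ y → w ∈ ys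
  keep (here refl) w≢y = ⊥-elim (w≢y refl)
  keep (there w∈ys) _ = w∈ys
remove {z = z} (y ∷ ys) (there z∈ys) with remove ys z∈ys
... | ys′ , len , keep = y ∷ ys′ , cong ℕ.suc len , keep′
  where
  keep′ : ∀ {w} → w ∈ y ∷ ys → w ≢ z → w ∈ y ∷ ys′
  keep′ (here w≡y) _ = here w≡y
  keep′ (there w∈ys) w≢z = there (keep w∈ys w≢z)

unique-⊆⇒length-≤ : ∀ {A : Set} {xs ys : List A} → Unique xs → xs ⊆ ys →
                    length xs ≤ length ys
unique-⊆⇒length-≤ {xs = []} _ _ = ℕ.z≤n
unique-⊆⇒length-≤ {xs = x ∷ xs} {ys} (x∉xs ∷ u) xs⊆ys
  with remove ys (xs⊆ys (here refl))
... | ys′ , len , keep = subst (ℕ.suc (length xs) ≤_) len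
  (ℕ.s≤s (unique-⊆⇒length-≤ u λ w∈xs →
    keep (xs⊆ys (there w∈xs)) (λ w≡x → All.lookup x∉xs w∈xs (sym w≡x))))

module Guessing {n} (D : SignedDigraph n) where

  _≼⟨_⟩_ : ∀ {s} → Conf n s → Fin n → Conf n s → Set
  x ≼⟨ i ⟩ y = ∀ j → lookup x j ⊑⟨ D j i ⟩ lookup y j

  ≼-refl : ∀ {s} i (x : Conf n s) → x ≼⟨ i ⟩ x
  ≼-refl i x j = ⊑-reflexive (D j i) refl

  ≼-trans : ∀ {s} i {x y z : Conf n s} → x ≼⟨ i ⟩ y → y ≼⟨ i ⟩ z → x ≼⟨ i ⟩ z
  ≼-trans i x≼y y≼z j = ⊑-trans (D j i) (x≼y j) (y≼z j)

  ≼-dec : ∀ {s} i (x y : Conf n s) → Dec (x ≼⟨ i ⟩ y)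
  ≼-dec i x y = FP.all? λ j → ⊑-dec (D j i) (lookup x j) (lookup y j)

  agreeOn⇒≼ : ∀ {s} i (x y : Conf n s) →
              (∀ j → InN D j i → lookup x j ≡ lookup y j) → x ≼⟨ i ⟩ y
  agreeOn⇒≼ i x y h j with D j i in arc
  ... | nothing = tt
  ... | just σ = ⊑-reflexive (just σ) (h j λ none → just≢nothing (trans (sym arc) none))
    where
    just≢nothing : just σ ≢ nothing
    just≢nothing ()

  agreeExcept⇒≼ : ∀ {s} i j (x y : Conf n s) → AgreeExcept j x y →
                  lookup x j ⊑⟨ D j i ⟩ lookup y j → x ≼⟨ i ⟩ y
  agreeExcept⇒≼ i j x y x~y xj⊑yj k with k FP.≟ j
  ... | yes refl = xj⊑yj
  ... | no k≢j = ⊑-reflexive (D k i) (x~y k k≢j)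

  Monotone : ∀ {s} → (Conf n s → Conf n s) → Set
  Monotone {s} f = ∀ i {x y : Conf n s} → x ≼⟨ i ⟩ y →
                   lookup (f x) i F.≤ lookup (f y) i

  monotone⇒inF : ∀ {s} {f : Conf n s → Conf n s} → Monotone f → InF D f
  monotone⇒inF mono = record
    { local = λ i x y h → FP.≤-antisym
        (mono i (agreeOn⇒≼ i x y h)) (mono i (agreeOn⇒≼ i y x λ j j∈N → sym (h j j∈N)))
    ; mono⁺ = λ i j arc x y x~y xj≤yj →
        mono i (agreeExcept⇒≼ i j x y x~y (subst (λ σ → lookup x j ⊑⟨ σ ⟩ lookup y j)
                                              (sym arc) xj≤yj))
    ; mono⁻ = λ i j arc x y x~y xj≤yj →
        mono i (agreeExcept⇒≼ i j y x (λ k k≢j → sym (x~y k k≢j))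
                 (subst (λ σ → lookup y j ⊑⟨ σ ⟩ lookup x j) (sym arc) xj≤yj))
    }

  module _ {s} {f : Conf n s → Conf n s} (f∈F : InF D f) where
    open InF f∈F

    inF-step : ∀ i j {x y : Conf n s} → AgreeExcept j x y →
               lookup x j ⊑⟨ D j i ⟩ lookup y j → lookup (f x) i F.≤ lookup (f y) i
    inF-step i j {x} {y} x~y xj⊑yj with D j i in arc
    ... | nothing = FP.≤-reflexive (local i x y λ k k∈N → x~y k λ { refl → k∈N arc })
    ... | just zer = FP.≤-reflexive (local i x y λ k _ → agree-everywhere {x = x} {y} x~y xj⊑yj k)
    ... | just pos = mono⁺ i j arc x y x~y xj⊑yj
    ... | just neg = mono⁻ i j arc y x (λ k k≢j → sym (x~y k k≢j)) xj⊑yj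

    -- Every f ∈ F(D,s) is monotone: go from x to y by overwriting the
    -- coordinates one at a time with their values in y.
    inF⇒monotone : Monotone f
    inF⇒monotone i {x} {y} x≼y =
      walk (allFin n) x x≼y (λ k k∉ → ⊥-elim (k∉ (∈-allFin k)))
      where
      -- invariant: z ≼⟨ i ⟩ y, and z already equals y off the list js
      walk : (js : List (Fin n)) (z : Conf n s) → z ≼⟨ i ⟩ y →
             (∀ k → ¬ k ∈ js → lookup z k ≡ lookup y k) →
             lookup (f z) i F.≤ lookup (f y) i
      walk [] z _ z≈y = FP.≤-reflexive (local i z y λ k _ → z≈y k λ ())
      walk (j ∷ js) z z≼y z≈y =
        FP.≤-trans (inF-step i j (update-agreeExcept z j yj) z⊑z′)
                   (walk js z′ z′≼y z′≈y)
        where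
        yj : Fin s
        yj = lookup y j
        z′ : Conf n s
        z′ = z [ j ]≔ yj
        z′j≡yj : lookup z′ j ≡ yj
        z′j≡yj = VP.lookup∘update j z yj
        z′k≡zk : ∀ {k} → k ≢ j → lookup z′ k ≡ lookup z k
        z′k≡zk k≢j = VP.lookup∘update′ k≢j z yj
        z⊑z′ : lookup z j ⊑⟨ D j i ⟩ lookup z′ j
        z⊑z′ = subst (lookup z j ⊑⟨ D j i ⟩_) (sym z′j≡yj) (z≼y j)
        z′≼y : z′ ≼⟨ i ⟩ y
        z′≼y k with k FP.≟ j
        ... | yes refl = ⊑-reflexive (D j i) z′j≡yj
        ... | no k≢j = subst (_⊑⟨ D k i ⟩ lookup y k) (sym (z′k≡zk k≢j)) (z≼y k)
        z′≈y : ∀ k → ¬ k ∈ js → lookup z′ k ≡ lookup y k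
        z′≈y k k∉js with k FP.≟ j
        ... | yes refl = z′j≡yj
        ... | no k≢j = trans (z′k≡zk k≢j) (z≈y k λ
          { (here k≡j) → k≢j k≡j ; (there k∈js) → k∉js k∈js })

    fixed-ordered : ∀ {x y} → IsFix f x → IsFix f y → ∀ i → x ≼⟨ i ⟩ y →
                    lookup x i F.≤ lookup y i
    fixed-ordered {x} {y} fx fy i x≼y =
      subst₂ F._≤_ (cong (λ v → lookup v i) fx) (cong (λ v → lookup v i) fy)
                   (inF⇒monotone i x≼y)

  Separated : ∀ {s} → List (Conf n s) → Set
  Separated Z = ∀ {x y} → x ∈ Z → y ∈ Z → ∀ i → x ≼⟨ i ⟩ y →
                lookup x i F.≤ lookup y i

  -- A violating pair would have no common f, i.e. would be an edge of G(D,s).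
  independent⇒separated : ∀ {s} {Z : List (Conf n s)} → Independent s D Z →
                          Separated Z
  independent⇒separated (_ , indep) {x} {y} x∈Z y∈Z i x≼y
    with lookup x i FP.≤? lookup y i
  ... | yes xi≤yi = xi≤yi
  ... | no xi≰yi = ⊥-elim (indep x y x∈Z y∈Z (x≢y , no-common-f))
    where
    x≢y : x ≢ y
    x≢y refl = xi≰yi FP.≤-refl
    no-common-f : ¬ (Σ _ λ f → InF D f × IsFix f x × IsFix f y)
    no-common-f (f , f∈F , fx , fy) = xi≰yi (fixed-ordered f∈F fx fy i x≼y)

  -- The network associated with a list Z of configurations (s = suc k, so
  -- that 0 is available as the value of an empty maximum).
  module _ {k} (Z : List (Conf n (ℕ.suc k))) where
    open import Data.List.Extrema (FP.≤-totalOrder (ℕ.suc k)) using (max; max-mono-⊆; max≈v⁺)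

    candidates : Fin n → Conf n (ℕ.suc k) → List (Fin (ℕ.suc k))
    candidates i z = map (λ a → lookup a i) (filter (λ a → ≼-dec i a z) Z)

    fromSet : Conf n (ℕ.suc k) → Conf n (ℕ.suc k)
    fromSet z = tabulate λ i → max F.zero (candidates i z)

    -- Going up along ≼⟨ i ⟩ only adds candidates, by transitivity.
    fromSet-monotone : Monotone fromSet
    fromSet-monotone i {z} {w} z≼w =
      subst₂ F._≤_ (sym (VP.lookup∘tabulate _ i)) (sym (VP.lookup∘tabulate _ i))
        (max-mono-⊆ ℕ.z≤n
          (Subset.map⁺ (λ a → lookup a i) (Subset.filter⁺′ (λ a → ≼-dec i a z) (λ a → ≼-dec i a w)
             (λ {a} a≼z → ≼-trans i {a} {z} {w} a≼z z≼w) (Subset.⊆-refl {x = Z}))))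

    -- For y ∈ Z, y_i is itself a candidate at y and, by separation, the largest.
    fromSet-fixes : Separated Z → ∀ {y} → y ∈ Z → IsFix fromSet y
    fromSet-fixes sep {y} y∈Z =
      trans (VP.tabulate-cong value≡) (VP.tabulate∘lookup y)
      where
      value≡ : ∀ i → max F.zero (candidates i y) ≡ lookup y i
      value≡ i = max≈v⁺
        (∈-map⁺ (λ a → lookup a i) (∈-filter⁺ (λ a → ≼-dec i a y) y∈Z (≼-refl i y)))
        (All.tabulate λ v∈ → bounded (∈-map⁻ (λ a → lookup a i) v∈))
        ℕ.z≤n
        where
        bounded : ∀ {v} → Σ _ (λ a → a ∈ filter (λ a → ≼-dec i a y) Z × v ≡ lookup a i) →
                  v F.≤ lookup y i
        bounded (a , a∈ , refl) =
          let (a∈Z , a≼y) = ∈-filter⁻ (λ a → ≼-dec i a y) {xs = Z} a∈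
          in sep a∈Z y∈Z i a≼y

  fromSet-inF : ∀ {k} (Z : List (Conf n (ℕ.suc k))) → InF D (fromSet Z)
  fromSet-inF Z = monotone⇒inF (fromSet-monotone Z)

  independent⇒fixed : ∀ {k} (Z : List (Conf n (ℕ.suc k))) → Independent (ℕ.suc k) D Z →
    Σ (Conf n (ℕ.suc k) → Conf n (ℕ.suc k)) λ f → InF D f × (∀ x → x ∈ Z → IsFix f x)
  independent⇒fixed Z indep =
    fromSet Z , fromSet-inF Z ,
    λ x x∈Z → fromSet-fixes Z (independent⇒separated indep) x∈Z

  fixed⇒independent : ∀ {s} {f : Conf n s → Conf n s} → InF D f →
    (Ls : List (Conf n s)) → Unique Ls → (∀ x → (x ∈ Ls) ⇔ IsFix f x) →
    Independent s D Ls
  fixed⇒independent {f = f} f∈F Ls u iff =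
    u , λ x y x∈ y∈ (_ , no-common-f) →
      no-common-f (f , f∈F , Equivalence.to (iff x) x∈ , Equivalence.to (iff y) y∈)

  independent-≤-fixed : ∀ {k} (Z : List (Conf n (ℕ.suc k))) → Independent (ℕ.suc k) D Z →
                        length Z ≤ length (fixedPoints (fromSet Z))
  independent-≤-fixed Z indep = unique-⊆⇒length-≤ (proj₁ indep)
    λ x∈Z → ∈-fixedPoints (fromSet-fixes Z (independent⇒separated indep) x∈Z)

  -- Each side
  -- bounds the other because Fix(f) is independent (fixed⇒independent) and
  -- every independent Z lies inside Fix(fromSet Z) (independent-≤-fixed).
  maxFix⇔indepNumber : ∀ {k} m → IsMaxFix (ℕ.suc k) D m ⇔ IsIndepNumber (ℕ.suc k) D m
  maxFix⇔indepNumber {k} m = mk⇔ maxFix⇒indepNumber indepNumber⇒maxFix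
    where
    maxFix⇒indepNumber : IsMaxFix (ℕ.suc k) D m → IsIndepNumber (ℕ.suc k) D m
    maxFix⇒indepNumber ((f , f∈F , Ls , u , iff , len) , fix≤m) =
      (Ls , fixed⇒independent f∈F Ls u iff , len) ,
      λ Z indep → ℕP.≤-trans (independent-≤-fixed Z indep)
        (fix≤m (fromSet Z) _ (fromSet-inF Z) (fixedPoints-count (fromSet Z)))

    indepNumber⇒maxFix : IsIndepNumber (ℕ.suc k) D m → IsMaxFix (ℕ.suc k) D m
    indepNumber⇒maxFix ((Z , indep , lenZ) , indep≤m) =
      (fromSet Z , fromSet-inF Z , subst (FixCount (fromSet Z)) |Fix|≡m
                                         (fixedPoints-count (fromSet Z))) ,
      fix≤m
      where
      fix≤m : ∀ g j → InF D g → FixCount {n} {ℕ.suc k} g j → j ≤ m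
      fix≤m g j g∈F (Ls , u , iff , len) =
        subst (_≤ m) len (indep≤m Ls (fixed⇒independent g∈F Ls u iff))
      |Fix|≡m : length (fixedPoints (fromSet Z)) ≡ m
      |Fix|≡m = ℕP.≤-antisym
        (fix≤m (fromSet Z) _ (fromSet-inF Z) (fixedPoints-count (fromSet Z)))
        (subst (_≤ length (fixedPoints (fromSet Z))) lenZ (independent-≤-fixed Z indep))

-- The construction needs only s ≥ 1 and works for the empty set as well, so
-- the hypotheses 2 ≤ s and Z ≢ [] are used only to fix s = suc k.
theorem1 : ∀ {n} (D : SignedDigraph n) (s : ℕ) → 2 ≤ s →
    (∀ (Z : List (Conf n s)) → Z ≢ [] → Independent s D Z →
      Σ (Conf n s → Conf n s) λ f → InF D f × (∀ x → x ∈ Z → IsFix f x))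
    × (∀ m → IsMaxFix s D m ⇔ IsIndepNumber s D m)
theorem1 D (ℕ.suc k) _ =
  (λ Z _ → independent⇒fixed Z) , maxFix⇔indepNumber
  where open Guessing D
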